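{- Let $a\le b$ and $n\ge1$ be integers, let $h$ be a height function on $[n]$ with corner $c$, and let $T$ be a spanning tree of $K^{ab}_n[h]$. Let $v_1,\dots,v_m$ be the neighbours of $c$ in $T$ (joined to $c$ by edges $g_i(c,v_i)$), and for each $i$ let $T_i$ be the connected component of $T$ minus the vertex $c$ that contains $v_i$, with vertex set $V_i$. Then $T$ is an NBC tree of $K^{ab}_n[h]$ with respect to $O_h$ if and only if, for every $i$, $T_i$ is an NBC tree of the subgraph of $K^{ab}_n[h]$ induced on $V_i$ (with respect to the restriction of $O_h$), and $v_i$ is the $O_h$-smallest vertex of $V_i$ that is adjacent to $c$ in $K^{ab}_n[h]$.
   Context: For integers $a\le b$ and $n\ge1$, $K^{ab}_n$ is the integral gain graph on vertex set $[n]=\{1,\dots,n\}$ having, for every pair $i<j$ and every integer $g$ with $a\le g\le b$, an edge $g(i,j)$ from $i$ to $j$ with gain $g$ (reversing orientation negates the gain). A circle is a connected 2-regular subgraph; it is balanced if the sum of the gains of its edges, traversed cyclically in one direction, is $0$. Given a total order on an edge set, a broken circuit is a balanced circle minus its smallest edge; an NBC set is an edge set containing no circle and no broken circuit; an NBC tree is an NBC set which is a spanning tree of the given vertex set. A height function on $[n]$ is a function $h:[n]\to\mathbb{N}$ with $h^{ -1}(0)\ne\emptyset$; its corner is the smallest integer among the vertices of greatest height. An edge $g(i,j)$ is coherent with $h$ if $h(j)-h(i)=g$, and $K^{ab}_n[h]$ is the spanning subgraph of coherent edges (it has at most one edge between two vertices and all its circles are balanced). The order $O_h$ on $[n]$: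 $i<_{O_h}j$ iff $h(i)>h(j)$, or $h(i)=h(j)$ and $i<j$; on edges of $K^{ab}_n[h]$ it is extended lexicographically (write each edge as the pair of its endpoints in $O_h$-increasing order and compare pairs lexicographically). -}

module Defs where

open import Data.Nat as ℕ using (ℕ; zero; suc)
open import Data.Integer as ℤ using (ℤ; +_)
open import Data.Fin as Fin using (Fin; toℕ)
open import Data.List using (List; []; _∷_; _++_; zip; length; map; foldr)
open import Data.List.Relation.Unary.All using (All)
open import Data.List.Relation.Unary.Unique.Propositional using (Unique)
open import Data.List.Membership.Propositional using (_∈_)
open import Data.Product using (Σ; ∃; _×_; _,_; proj₁; proj₂)
open import Data.Sum using (_⊎_)
open import Relation.Nullary using (¬_; Dec; does)
open import Relation.Nullary.Decidable using (_⊎-dec_; _×-dec_)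
open import Relation.Binary.PropositionalEquality using (_≡_; _≢_)
open import Relation.Binary.Construct.Closure.ReflexiveTransitive using (Star)
open import Data.Bool using (if_then_else_)

-- Vertices of [n] are represented by Fin n (vertex k+1 of the paper is
-- the element k of Fin n; the natural order is preserved).

Vertex : ℕ → Set
Vertex n = Fin n

-- Graphs on Fin n are given by an adjacency relation (edge sets by a
-- relation whose pairs (u , v) are the edges {u , v}).
Rel : ℕ → Set₁
Rel n = Fin n → Fin n → Set

VSet : ℕ → Set₁
VSet n = Fin n → Set

Full : ∀ {n} → VSet n
Full _ = Data.Unit.⊤ where import Data.Unit

IsHeightFunction : ∀ {n} → (Fin n → ℕ) → Set
IsHeightFunction {n} h = ∃ λ (i : Fin n) → h i ≡ 0

IsCorner : ∀ {n} → (Fin n → ℕ) → Fin n → Set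
IsCorner {n} h c =
  ((i : Fin n) → h i ℕ.≤ h c) × ((i : Fin n) → h i ≡ h c → c Fin.≤ i)

-- the edge g(i,j), i < j, with g = h(j) - h(i) exists in K^{ab}_n
-- (i.e. a ≤ g ≤ b) and is then coherent with h
Coherent : ∀ {n} → ℤ → ℤ → (Fin n → ℕ) → Fin n → Fin n → Set
Coherent a b h i j =
  (i Fin.< j) × (a ℤ.≤ (+ h j) ℤ.- (+ h i)) × ((+ h j) ℤ.- (+ h i) ℤ.≤ b)

-- adjacency in K^{ab}_n[h] (at most one edge between two vertices)
KAdj : ∀ {n} → ℤ → ℤ → (Fin n → ℕ) → Rel n
KAdj a b h i j = Coherent a b h i j ⊎ Coherent a b h j i

gain : ∀ {n} → (Fin n → ℕ) → Fin n × Fin n → ℤ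
gain h (u , v) = (+ h v) ℤ.- (+ h u)

_<[_]_ : ∀ {n} → Fin n → (Fin n → ℕ) → Fin n → Set
i <[ h ] j = (h j ℕ.< h i) ⊎ ((h i ≡ h j) × (i Fin.< j))

<O? : ∀ {n} (h : Fin n → ℕ) (i j : Fin n) → Dec (i <[ h ] j)
<O? h i j = (h j ℕ.<? h i) ⊎-dec ((h i ℕ.≟ h j) ×-dec (i Fin.<? j))

minO maxO : ∀ {n} → (Fin n → ℕ) → Fin n → Fin n → Fin n
minO h i j = if does (<O? h i j) then i else j
maxO h i j = if does (<O? h i j) then j else i

EdgeLt : ∀ {n} → (Fin n → ℕ) → Fin n × Fin n → Fin n × Fin n → Set
EdgeLt h (u , v) (u' , v') =
  (minO h u v <[ h ] minO h u' v')
  ⊎ ((minO h u v ≡ minO h u' v') × (maxO h u v <[ h ] maxO h u' v'))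

SameEdge : ∀ {n} → Fin n × Fin n → Fin n × Fin n → Set
SameEdge (u , v) (u' , v') = ((u ≡ u') × (v ≡ v')) ⊎ ((u ≡ v') × (v ≡ u'))

cycEdges : ∀ {n} → List (Fin n) → List (Fin n × Fin n)
cycEdges [] = []
cycEdges (x ∷ xs) = zip (x ∷ xs) (xs ++ x ∷ [])

IsCircle : ∀ {n} → VSet n → Rel n → List (Fin n) → Set
IsCircle U E vs =
  (3 ℕ.≤ length vs) × Unique vs × All U vs
  × All (λ e → E (proj₁ e) (proj₂ e)) (cycEdges vs)

IsBalanced : ∀ {n} → (Fin n → ℕ) → List (Fin n) → Set
IsBalanced h vs = foldr ℤ._+_ (+ 0) (map (gain h) (cycEdges vs)) ≡ + 0

Connected : ∀ {n} → VSet n → Rel n → Fin n → Fin n → Set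
Connected U E x y = U x × Star (λ u v → U u × U v × E u v) x y

IsSubEdgeSet : ∀ {n} → VSet n → Rel n → Rel n → Set
IsSubEdgeSet {n} U G T = (u v : Fin n) → T u v → U u × U v × G u v

Acyclic : ∀ {n} → VSet n → Rel n → Set
Acyclic U T = ∀ vs → ¬ IsCircle U T vs

IsSpanningTree : ∀ {n} → VSet n → Rel n → Rel n → Set
IsSpanningTree {n} U G T =
  IsSubEdgeSet U G T
  × ((x y : Fin n) → U x → U y → Connected U T x y)
  × Acyclic U T

ContainsBrokenCircuit : ∀ {n} → (Fin n → ℕ) → Rel n → List (Fin n) → Set
ContainsBrokenCircuit h T vs =
  Σ (_ × _) λ e → (e ∈ cycEdges vs) ×
    (∀ e' → e' ∈ cycEdges vs → ¬ SameEdge e e' →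
       EdgeLt h e e' × T (proj₁ e') (proj₂ e'))

IsNBCSet : ∀ {n} → (Fin n → ℕ) → VSet n → Rel n → Rel n → Set
IsNBCSet h U G T =
  IsSubEdgeSet U G T × Acyclic U T
  × (∀ vs → IsCircle U G vs → IsBalanced h vs → ¬ ContainsBrokenCircuit h T vs)

IsNBCTree : ∀ {n} → (Fin n → ℕ) → VSet n → Rel n → Rel n → Set
IsNBCTree h U G T = IsNBCSet h U G T × IsSpanningTree U G T

Comp : ∀ {n} → Rel n → Fin n → Fin n → VSet n
Comp T c v x = Connected (λ u → u ≢ c) T v x

Restrict : ∀ {n} → Rel n → VSet n → Rel n
Restrict T V u w = T u w × V u × V w

IsMinO : ∀ {n} → (Fin n → ℕ) → VSet n → Fin n → Set
IsMinO {n} h P v = P v × ((w : Fin n) → P w → w ≢ v → v <[ h ] w)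

module Submission where

-- Write G for K^{ab}_n[h], <O for the order O_h and c for the corner.
--
-- Two facts drive the proof.  (1) c is the O_h-least vertex, so every edge
-- at c is smaller than every edge avoiding c, and two edges at c compare
-- like their other endpoints.  (2) The gains of G telescope along walks, so
-- every circle of G is balanced.
--
-- (⇒) NBC sets restrict to NBC sets on any vertex set, and T restricted to
-- a component V_v of T - c spans V_v.  If some w ∈ V_v adjacent to c were
-- O_h-below v, the circle c, v, …, w (closed through the T-path from v to
-- w) would have smallest edge wc, and its broken circuit would lie in T.
-- (⇐) Rotate a circle whose broken circuit lies in T so that its smallest
-- edge closes it.  If the circle avoids c it lies in a single component and
-- contradicts the NBC property there.  Otherwise by (1) its smallest edge
-- contains c, and the rest of the circle is a T-path from a T-neighbour v of
-- c to some w ≠ v adjacent to c with w <O v, against the minimality of v.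

open import Defs
open import Data.Nat using (ℕ; _≤_)
open import Data.Integer using (ℤ)
open import Data.Fin using (Fin)
open import Data.Product using (_×_)
open import Function.Bundles using (_⇔_)

open import Function.Bundles using (mk⇔)
open import Data.Nat using (z≤n; s≤s)
import Data.Nat.Properties as NP
import Data.Integer as Z
import Data.Integer.Properties as ZP
open import Data.Integer.Tactic.RingSolver using (solve-∀)
import Data.Fin.Properties as FP
open import Data.Product using (Σ; _,_; proj₁; proj₂)
import Data.Product as Prod
open import Data.Sum using (_⊎_; inj₁; inj₂)
import Data.Sum as Sum
open import Data.Empty using (⊥; ⊥-elim)
open import Data.Unit using (⊤; tt)
open import Data.Bool using (if_then_else_)
open import Data.List using (List; []; _∷_; _++_; length; map; foldr; zip)
open import Data.List.Relation.Unary.All using (All; []; _∷_)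
import Data.List.Relation.Unary.All as All
open import Data.List.Relation.Unary.All.Properties using (¬Any⇒All¬; All¬⇒¬Any)
open import Data.List.Relation.Unary.Any using (here; there)
open import Data.List.Membership.Propositional using (_∈_)
open import Data.List.Membership.Propositional.Properties using (∈-++⁺ˡ; ∈-++⁺ʳ; ∈-++⁻)
open import Data.List.Relation.Unary.Unique.Propositional using (Unique)
open import Data.List.Relation.Unary.AllPairs using ([]; _∷_)
import Data.List.Relation.Unary.AllPairs as AllPairs
open import Data.List.Relation.Binary.Permutation.Propositional using (_↭_; ↭⇒↭ₛ; ↭-sym)
open import Data.List.Relation.Binary.Permutation.Propositional.Properties using (↭-length; ++-comm)
import Data.List.Relation.Binary.Permutation.Setoid.Properties as PermSetoid
open import Relation.Nullary using (¬_; Dec; yes; no; does)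
open import Relation.Binary using (tri<; tri≈; tri>)
open import Relation.Binary.PropositionalEquality
open import Relation.Binary.Construct.Closure.ReflexiveTransitive using (Star; ε; _◅_; _◅◅_)
import Relation.Binary.Construct.Closure.ReflexiveTransitive as Star

-- Walks.  The walk x, y₁, …, y_k is represented by x and the list y₁ … y_k;
-- a circle x, y₁, …, y_k is that walk closed by the edge (y_k , x).

module Walks {n : ℕ} where
  open import Data.List.Membership.DecPropositional (FP._≟_ {n}) using (_∈?_)

  walkEdges : Fin n → List (Fin n) → List (Fin n × Fin n)
  walkEdges x [] = []
  walkEdges x (y ∷ ys) = (x , y) ∷ walkEdges y ys

  endpoint : Fin n → List (Fin n) → Fin n
  endpoint x [] = x
  endpoint x (y ∷ ys) = endpoint y ys

  zip-walk : ∀ x ys z → zip (x ∷ ys) (ys ++ z ∷ []) ≡ walkEdges x ys ++ (endpoint x ys , z) ∷ []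
  zip-walk x [] z = refl
  zip-walk x (y ∷ ys) z = cong ((x , y) ∷_) (zip-walk y ys z)

  cycEdges-walk : ∀ x ys → cycEdges (x ∷ ys) ≡ walkEdges x ys ++ (endpoint x ys , x) ∷ []
  cycEdges-walk x ys = zip-walk x ys x

  walkEdges-++ : ∀ x ys z zs →
    walkEdges x (ys ++ z ∷ zs) ≡ walkEdges x ys ++ (endpoint x ys , z) ∷ walkEdges z zs
  walkEdges-++ x [] z zs = refl
  walkEdges-++ x (y ∷ ys) z zs = cong ((x , y) ∷_) (walkEdges-++ y ys z zs)

  endpoint-++ : ∀ x ys z zs → endpoint x (ys ++ z ∷ zs) ≡ endpoint z zs
  endpoint-++ x [] z zs = refl
  endpoint-++ x (y ∷ ys) z zs = endpoint-++ y ys z zs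

  endpoint-∈ : ∀ x ys → endpoint x ys ∈ x ∷ ys
  endpoint-∈ x [] = here refl
  endpoint-∈ x (y ∷ ys) = there (endpoint-∈ y ys)

  walkEdge-ends : ∀ {e} x ys → e ∈ walkEdges x ys → proj₁ e ∈ x ∷ ys × proj₂ e ∈ ys
  walkEdge-ends x (y ∷ ys) (here refl) = here refl , here refl
  walkEdge-ends x (y ∷ ys) (there p) = Prod.map there there (walkEdge-ends y ys p)

  walkEdge-split : ∀ {e} x ys → e ∈ walkEdges x ys →
    Σ (List (Fin n)) λ A → Σ (Fin n) λ z → Σ (List (Fin n)) λ B →
      (ys ≡ A ++ z ∷ B) × (e ≡ (endpoint x A , z))
  walkEdge-split x (y ∷ ys) (here refl) = [] , y , ys , refl , refl
  walkEdge-split x (y ∷ ys) (there p) with walkEdge-split y ys p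
  ... | A , z , B , refl , refl = y ∷ A , z , B , refl , refl

  walkEdges-targets : ∀ {P : Fin n → Set} x ys → (∀ e → e ∈ walkEdges x ys → P (proj₂ e)) → All P ys
  walkEdges-targets x [] f = []
  walkEdges-targets x (y ∷ ys) f = f _ (here refl) ∷ walkEdges-targets y ys (λ e p → f e (there p))

  walk→star : ∀ {R : Rel n} x ys → (∀ e → e ∈ walkEdges x ys → R (proj₁ e) (proj₂ e)) →
    Star R x (endpoint x ys)
  walk→star x [] f = ε
  walk→star x (y ∷ ys) f = f _ (here refl) ◅ walk→star y ys (λ e p → f e (there p))

  star→walk : ∀ {R : Rel n} {x z} → Star R x z →
    Σ (List (Fin n)) λ ys → (∀ e → e ∈ walkEdges x ys → R (proj₁ e) (proj₂ e)) × (endpoint x ys ≡ z)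
  star→walk ε = [] , (λ e ()) , refl
  star→walk {R} (r ◅ s) with star→walk s
  ... | ys , f , eq = _ ∷ ys , steps , eq
    where
    steps : ∀ e → e ∈ walkEdges _ (_ ∷ ys) → R (proj₁ e) (proj₂ e)
    steps e (here refl) = r
    steps e (there p) = f e p

  SimpleWalk : (Fin n × Fin n → Set) → Fin n → Fin n → Set
  SimpleWalk R x z = Σ (List (Fin n)) λ zs →
    Unique (x ∷ zs) × (∀ e → e ∈ walkEdges x zs → R e) × (endpoint x zs ≡ z)

  dropUntil : ∀ {R : Fin n × Fin n → Set} x y zs → Unique (y ∷ zs) → x ∈ y ∷ zs →
    (∀ e → e ∈ walkEdges y zs → R e) → SimpleWalk R x (endpoint y zs)
  dropUntil x .x zs u (here refl) f = zs , u , f , refl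
  dropUntil x y (z ∷ zs) (_ ∷ u) (there p) f = dropUntil x z zs u p (λ e q → f e (there q))

  shortcut : ∀ {R : Fin n × Fin n → Set} x ys → (∀ e → e ∈ walkEdges x ys → R e) →
    SimpleWalk R x (endpoint x ys)
  shortcut x [] f = [] , [] ∷ [] , f , refl
  shortcut {R} x (y ∷ ys) f with shortcut y ys (λ e p → f e (there p))
  ... | zs , u , g , eq with x ∈? (y ∷ zs)
  ... | yes x∈ = let (B , uB , fB , eB) = dropUntil x y zs u x∈ g in B , uB , fB , trans eB eq
  ... | no x∉ = y ∷ zs , ¬Any⇒All¬ (y ∷ zs) x∉ ∷ u , steps , eq
    where
    steps : ∀ e → e ∈ walkEdges x (y ∷ zs) → R e
    steps e (here refl) = f e (here refl)
    steps e (there p) = g e p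

  cycEdge-cases : ∀ {e} x ys → e ∈ cycEdges (x ∷ ys) → e ∈ walkEdges x ys ⊎ e ≡ (endpoint x ys , x)
  cycEdge-cases {e} x ys m with ∈-++⁻ (walkEdges x ys) (subst (e ∈_) (cycEdges-walk x ys) m)
  ... | inj₁ p = inj₁ p
  ... | inj₂ (here p) = inj₂ p

  walkEdge∈cycle : ∀ {e} x ys → e ∈ walkEdges x ys → e ∈ cycEdges (x ∷ ys)
  walkEdge∈cycle {e} x ys p = subst (e ∈_) (sym (cycEdges-walk x ys)) (∈-++⁺ˡ p)

  closingEdge∈cycle : ∀ x ys → (endpoint x ys , x) ∈ cycEdges (x ∷ ys)
  closingEdge∈cycle x ys =
    subst ((endpoint x ys , x) ∈_) (sym (cycEdges-walk x ys)) (∈-++⁺ʳ (walkEdges x ys) (here refl))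

  cycEdge-ends : ∀ {e} vs → e ∈ cycEdges vs → proj₁ e ∈ vs × proj₂ e ∈ vs
  cycEdge-ends (x ∷ ys) m with cycEdge-cases x ys m
  ... | inj₁ p = Prod.map₂ there (walkEdge-ends x ys p)
  ... | inj₂ refl = endpoint-∈ x ys , here refl

  extendedWalk-out : ∀ {u} x ys z → u ∈ x ∷ ys →
    Σ (Fin n) λ y → (u , y) ∈ walkEdges x ys ++ (endpoint x ys , z) ∷ []
  extendedWalk-out x [] z (here refl) = z , here refl
  extendedWalk-out x (y ∷ ys) z (here refl) = y , here refl
  extendedWalk-out x (y ∷ ys) z (there m) = Prod.map₂ there (extendedWalk-out y ys z m)

  init-last : ∀ y ys → Σ (List (Fin n)) λ A → y ∷ ys ≡ A ++ endpoint y ys ∷ []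
  init-last y [] = [] , refl
  init-last y (y' ∷ ys) = Prod.map (y ∷_) (cong (y ∷_)) (init-last y' ys)

  unique-init : ∀ {z : Fin n} xs → Unique (xs ++ z ∷ []) → All (_≢ z) xs
  unique-init [] _ = []
  unique-init (x ∷ xs) (x∉ ∷ u) = All.lookup x∉ (∈-++⁺ʳ xs (here refl)) ∷ unique-init xs u

  unique-resp-↭ : {xs ys : List (Fin n)} → xs ↭ ys → Unique xs → Unique ys
  unique-resp-↭ p = PermSetoid.Unique-resp-↭ (setoid (Fin n)) (↭⇒↭ₛ p)

  record Rotation (vs : List (Fin n)) (e : Fin n × Fin n) : Set where
    field
      start : Fin n
      rest : List (Fin n)
      perm : (start ∷ rest) ↭ vs
      walk⊆cycle : ∀ e' → e' ∈ walkEdges start rest → e' ∈ cycEdges vs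
      closing : e ≡ (endpoint start rest , start)

  rotate : ∀ {e} vs → e ∈ cycEdges vs → Rotation vs e
  rotate (x ∷ xs) m with cycEdge-cases x xs m
  ... | inj₂ refl = record
    { start = x ; rest = xs ; perm = _↭_.refl
    ; walk⊆cycle = λ e' p → walkEdge∈cycle x xs p ; closing = refl }
  ... | inj₁ p with walkEdge-split x xs p
  ...   | A , z , B , refl , refl = record
    { start = z ; rest = B ++ x ∷ A ; perm = ++-comm (z ∷ B) (x ∷ A)
    ; walk⊆cycle = rotated⊆ ; closing = cong (_, z) (sym (endpoint-++ z B x A)) }
    where
    cycle-shape : cycEdges (x ∷ A ++ z ∷ B)
      ≡ (walkEdges x A ++ (endpoint x A , z) ∷ walkEdges z B) ++ (endpoint z B , x) ∷ []
    cycle-shape = trans (cycEdges-walk x (A ++ z ∷ B))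
      (cong₂ (λ es w → es ++ (w , x) ∷ []) (walkEdges-++ x A z B) (endpoint-++ x A z B))
    rotated⊆ : ∀ e' → e' ∈ walkEdges z (B ++ x ∷ A) → e' ∈ cycEdges (x ∷ A ++ z ∷ B)
    rotated⊆ e' q with ∈-++⁻ (walkEdges z B) (subst (e' ∈_) (walkEdges-++ z B x A) q)
    ... | inj₁ r = subst (e' ∈_) (sym cycle-shape) (∈-++⁺ˡ (∈-++⁺ʳ (walkEdges x A) (there r)))
    ... | inj₂ (here refl) = subst (e' ∈_) (sym cycle-shape) (∈-++⁺ʳ _ (here refl))
    ... | inj₂ (there r) = subst (e' ∈_) (sym cycle-shape) (∈-++⁺ˡ (∈-++⁺ˡ r))

  closing≠walkEdge : ∀ {e'} x ys → Unique (x ∷ ys) → 3 ≤ length (x ∷ ys) → e' ∈ walkEdges x ys →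
    ¬ SameEdge (endpoint x ys , x) e'
  closing≠walkEdge x ys (x∉ ∷ _) len p (inj₁ (_ , eq)) =
    All¬⇒¬Any x∉ (subst (_∈ ys) (sym eq) (proj₂ (walkEdge-ends x ys p)))
  closing≠walkEdge x (y ∷ []) u (s≤s (s≤s ())) p (inj₂ _)
  closing≠walkEdge x (y ∷ r ∷ rs) (_ ∷ y∉ ∷ _) len (here refl) (inj₂ (eq , _)) =
    All¬⇒¬Any y∉ (subst (_∈ r ∷ rs) eq (endpoint-∈ r rs))
  closing≠walkEdge x (y ∷ r ∷ rs) (x∉ ∷ _) len (there p) (inj₂ (_ , eq)) =
    All¬⇒¬Any x∉ (subst (_∈ y ∷ r ∷ rs) (sym eq) (proj₁ (walkEdge-ends y (r ∷ rs) p)))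

open Walks

-- Telescoping: the gains of K^{ab}_n[h] are differences of heights, so
-- every cyclic sequence of vertices has gain sum 0.

module Telescoping {n : ℕ} (h : Fin n → ℕ) where
  open Z using (+_; _+_; _-_)

  gainSum : List (Fin n × Fin n) → ℤ
  gainSum es = foldr _+_ (+ 0) (map (gain h) es)

  walk-telescopes : ∀ x ys z →
    gainSum (walkEdges x ys ++ (endpoint x ys , z) ∷ []) ≡ + h z - + h x
  walk-telescopes x [] z = ZP.+-identityʳ _
  walk-telescopes x (y ∷ ys) z = begin
    (+ h y - + h x) + gainSum (walkEdges y ys ++ (endpoint y ys , z) ∷ [])
      ≡⟨ cong (λ t → (+ h y - + h x) + t) (walk-telescopes y ys z) ⟩
    (+ h y - + h x) + (+ h z - + h y)
      ≡⟨ differences-add (+ h x) (+ h y) (+ h z) ⟩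
    + h z - + h x ∎
    where
    open ≡-Reasoning
    differences-add : ∀ p q r → (q - p) + (r - q) ≡ r - p
    differences-add = solve-∀

  all-balanced : ∀ vs → IsBalanced h vs
  all-balanced [] = refl
  all-balanced (x ∷ ys) = begin
    gainSum (cycEdges (x ∷ ys))                          ≡⟨ cong gainSum (cycEdges-walk x ys) ⟩
    gainSum (walkEdges x ys ++ (endpoint x ys , x) ∷ []) ≡⟨ walk-telescopes x ys x ⟩
    + h x - + h x                                        ≡⟨ ZP.+-inverseʳ (+ h x) ⟩
    + 0 ∎
    where open ≡-Reasoning

module Order {n : ℕ} (h : Fin n → ℕ) where

  _<O_ : Fin n → Fin n → Set
  x <O y = x <[ h ] y

  <O-asym : ∀ {x y} → x <O y → ¬ (y <O x)
  <O-asym (inj₁ p) (inj₁ q) = NP.<-asym p q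
  <O-asym (inj₁ p) (inj₂ (eq , _)) = NP.<-irrefl eq p
  <O-asym (inj₂ (eq , _)) (inj₁ q) = NP.<-irrefl eq q
  <O-asym (inj₂ (_ , p)) (inj₂ (_ , q)) = FP.<-asym p q

  <O-irrefl : ∀ {x} → ¬ (x <O x)
  <O-irrefl p = <O-asym p p

  <O-connex : ∀ x y → x ≢ y → ¬ (x <O y) → y <O x
  <O-connex x y x≢y x≮y with NP.<-cmp (h x) (h y)
  ... | tri< lt _ _ = inj₁ lt
  ... | tri> _ _ gt = ⊥-elim (x≮y (inj₁ gt))
  ... | tri≈ _ eq _ with FP.<-cmp x y
  ...   | tri< lt _ _ = ⊥-elim (x≮y (inj₂ (eq , lt)))
  ...   | tri≈ _ x≡y _ = ⊥-elim (x≢y x≡y)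
  ...   | tri> _ _ gt = inj₂ (sym eq , gt)

  if-yes : ∀ {P : Set} (d : Dec P) {i j : Fin n} → P → (if does d then i else j) ≡ i
  if-yes (yes _) _ = refl
  if-yes (no ¬p) p = ⊥-elim (¬p p)

  if-no : ∀ {P : Set} (d : Dec P) {i j : Fin n} → ¬ P → (if does d then i else j) ≡ j
  if-no (yes p) ¬p = ⊥-elim (¬p p)
  if-no (no _) _ = refl

  orient-< : ∀ {x y} → x <O y → minO h x y ≡ x × maxO h x y ≡ y
  orient-< {x} {y} x<y = if-yes (<O? h x y) x<y , if-yes (<O? h x y) x<y

  orient-≮ : ∀ {x y} → ¬ (x <O y) → minO h x y ≡ y × maxO h x y ≡ x
  orient-≮ {x} {y} x≮y = if-no (<O? h x y) x≮y , if-no (<O? h x y) x≮y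

  minO-endpoint : ∀ x y → minO h x y ≡ x ⊎ minO h x y ≡ y
  minO-endpoint x y with <O? h x y
  ... | yes x<y = inj₁ (if-yes (<O? h x y) x<y)
  ... | no x≮y = inj₂ (if-no (<O? h x y) x≮y)

module Corner {n : ℕ} (h : Fin n → ℕ) (c : Fin n) (corner : IsCorner h c) where
  open Order h

  corner-least : ∀ x → x ≢ c → c <O x
  corner-least x x≢c with NP.m≤n⇒m<n∨m≡n (proj₁ corner x)
  ... | inj₁ lt = inj₁ lt
  ... | inj₂ eq = inj₂ (sym eq , FP.≤∧≢⇒< (proj₂ corner x eq) (λ e → x≢c (sym e)))

  nothing-below-corner : ∀ x → ¬ (x <O c)
  nothing-below-corner x (inj₁ lt) = NP.<⇒≱ lt (proj₁ corner x)
  nothing-below-corner x (inj₂ (eq , lt)) = NP.<⇒≱ lt (proj₂ corner x eq)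

  cornerEdge-out : ∀ x → x ≢ c → minO h c x ≡ c × maxO h c x ≡ x
  cornerEdge-out x x≢c = orient-< (corner-least x x≢c)

  cornerEdge-in : ∀ x → minO h x c ≡ c × maxO h x c ≡ x
  cornerEdge-in x = orient-≮ (nothing-below-corner x)

  cornerEdges-compare : ∀ {e e' : Fin n × Fin n} {x y} →
    minO h (proj₁ e) (proj₂ e) ≡ c → minO h (proj₁ e') (proj₂ e') ≡ c →
    maxO h (proj₁ e) (proj₂ e) ≡ x → maxO h (proj₁ e') (proj₂ e') ≡ y → EdgeLt h e e' → x <O y
  cornerEdges-compare m m' _ _ (inj₁ lt) = ⊥-elim (<O-irrefl (subst₂ _<O_ m m' lt))
  cornerEdges-compare _ _ M M' (inj₂ (_ , lt)) = subst₂ _<O_ M M' lt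

  cornerEdges-order : ∀ {e e' : Fin n × Fin n} {x y} →
    minO h (proj₁ e) (proj₂ e) ≡ c → minO h (proj₁ e') (proj₂ e') ≡ c →
    maxO h (proj₁ e) (proj₂ e) ≡ x → maxO h (proj₁ e') (proj₂ e') ≡ y → x <O y → EdgeLt h e e'
  cornerEdges-order m m' M M' x<y = inj₂ (trans m (sym m') , subst₂ _<O_ (sym M) (sym M') x<y)

  avoiding-min : ∀ x y → x ≢ c → y ≢ c → minO h x y ≢ c
  avoiding-min x y x≢c y≢c with minO-endpoint x y
  ... | inj₁ eq = λ e → x≢c (trans (sym eq) e)
  ... | inj₂ eq = λ e → y≢c (trans (sym eq) e)

  cornerEdge<avoiding : ∀ {e e' : Fin n × Fin n} → minO h (proj₁ e) (proj₂ e) ≡ c →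
    proj₁ e' ≢ c → proj₂ e' ≢ c → EdgeLt h e e'
  cornerEdge<avoiding {e' = x , y} m x≢c y≢c =
    inj₁ (subst (_<O minO h x y) (sym m) (corner-least _ (avoiding-min x y x≢c y≢c)))

  avoiding≮cornerEdge : ∀ {e e' : Fin n × Fin n} → proj₁ e ≢ c → proj₂ e ≢ c →
    minO h (proj₁ e') (proj₂ e') ≡ c → ¬ EdgeLt h e e'
  avoiding≮cornerEdge {x , y} _ _ m' (inj₁ lt) = nothing-below-corner _ (subst (_ <O_) m' lt)
  avoiding≮cornerEdge {x , y} x≢c y≢c m' (inj₂ (eq , _)) = avoiding-min x y x≢c y≢c (trans eq m')

module Restriction {n : ℕ} (h : Fin n → ℕ) (G T : Rel n) where

  subEdgeSet-restrict : ∀ U → IsSubEdgeSet Full G T → IsSubEdgeSet U G (Restrict T U)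
  subEdgeSet-restrict U sub u w (t , Uu , Uw) = Uu , Uw , proj₂ (proj₂ (sub u w t))

  acyclic-restrict : ∀ U → Acyclic Full T → Acyclic U (Restrict T U)
  acyclic-restrict U acyclic vs (len , uq , _ , es) =
    acyclic vs (len , uq , All.universal (λ _ → tt) vs , All.map proj₁ es)

  circle-unrestrict : ∀ {U : VSet n} {E vs} → IsCircle U E vs → IsCircle Full E vs
  circle-unrestrict {vs = vs} (len , uq , _ , es) = len , uq , All.universal (λ _ → tt) vs , es

  circle-restrict : ∀ {U : VSet n} {E vs} → All U vs → IsCircle Full E vs → IsCircle U E vs
  circle-restrict inU (len , uq , _ , es) = len , uq , inU , es

  brokenCircuit-unrestrict : ∀ {U} vs →
    ContainsBrokenCircuit h (Restrict T U) vs → ContainsBrokenCircuit h T vs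
  brokenCircuit-unrestrict vs (e , e∈ , larger) = e , e∈ , λ e' m ns → Prod.map₂ proj₁ (larger e' m ns)

  brokenCircuit-restrict : ∀ {U} vs → All U vs →
    ContainsBrokenCircuit h T vs → ContainsBrokenCircuit h (Restrict T U) vs
  brokenCircuit-restrict vs inU (e , e∈ , larger) = e , e∈ , λ e' m ns →
    let (lt , t) = larger e' m ns ; (u∈ , w∈) = cycEdge-ends vs m
    in lt , t , All.lookup inU u∈ , All.lookup inU w∈

  NBC-restrict : ∀ U → IsNBCSet h Full G T → IsNBCSet h U G (Restrict T U)
  NBC-restrict U (sub , acyclic , nbc) =
    subEdgeSet-restrict U sub , acyclic-restrict U acyclic ,
    λ vs circle bal cbc → nbc vs (circle-unrestrict circle) bal (brokenCircuit-unrestrict vs cbc)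

module Main {n : ℕ} (a b : ℤ) (h : Fin n → ℕ) (c : Fin n) (corner : IsCorner h c)
            (T : Rel n) (T-sym : ∀ u v → T u v → T v u)
            (spanning : IsSpanningTree Full (KAdj a b h) T) where
  open import Data.List.Membership.DecPropositional (FP._≟_ {n}) using (_∈?_)
  open Order h
  open Corner h c corner
  open Restriction h (KAdj a b h) T
  open Telescoping h using (all-balanced)

  G : Rel n
  G = KAdj a b h

  G-irrefl : ∀ {u w} → G u w → u ≢ w
  G-irrefl (inj₁ (lt , _)) refl = FP.<-irrefl refl lt
  G-irrefl (inj₂ (lt , _)) refl = FP.<-irrefl refl lt

  G-sym : ∀ {u w} → G u w → G w u
  G-sym = Sum.swap

  T⊆G : ∀ {u w} → T u w → G u w
  T⊆G {u} {w} t = proj₂ (proj₂ (proj₁ spanning u w t))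

  neighbour≢c : ∀ {v} → T c v → v ≢ c
  neighbour≢c t v≡c = G-irrefl (T⊆G t) (sym v≡c)

  OffCorner : Rel n
  OffCorner u w = u ≢ c × w ≢ c × T u w

  offCorner-sym : ∀ {u w} → OffCorner u w → OffCorner w u
  offCorner-sym {u} {w} (u≢c , w≢c , t) = w≢c , u≢c , T-sym u w t

  comp-step : ∀ {v x y} → Comp T c v x → OffCorner x y → Comp T c v y
  comp-step (v≢c , path) step = v≢c , path ◅◅ step ◅ ε

  comp-walk : ∀ {v} x ys → Comp T c v x → (∀ e → e ∈ walkEdges x ys → T (proj₁ e) (proj₂ e)) →
    All (_≢ c) (x ∷ ys) → All (Comp T c v) (x ∷ ys)
  comp-walk x [] x∈ _ _ = x∈ ∷ []
  comp-walk x (y ∷ ys) x∈ inT (x≢c ∷ y≢c ∷ avoid) =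
    x∈ ∷ comp-walk y ys (comp-step x∈ (x≢c , y≢c , inT _ (here refl))) (λ e p → inT e (there p)) (y≢c ∷ avoid)

  comp-path : ∀ {v x y} → Comp T c v x → Star OffCorner x y →
    Star (λ u w → Comp T c v u × Comp T c v w × Restrict T (Comp T c v) u w) x y
  comp-path x∈ ε = ε
  comp-path x∈ (step ◅ path) =
    let y∈ = comp-step x∈ step in (x∈ , y∈ , proj₂ (proj₂ step) , x∈ , y∈) ◅ comp-path y∈ path

  component-spanning : ∀ v → IsSpanningTree (Comp T c v) G (Restrict T (Comp T c v))
  component-spanning v =
    subEdgeSet-restrict (Comp T c v) (proj₁ spanning) ,
    (λ x y x∈ y∈ → x∈ , comp-path x∈ (Star.reverse offCorner-sym (proj₂ x∈) ◅◅ proj₂ y∈)) ,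
    acyclic-restrict (Comp T c v) (proj₂ (proj₂ spanning))

  comp-of-neighbour : ∀ x → x ≢ c → Σ (Fin n) λ v → T c v × Comp T c v x
  comp-of-neighbour x x≢c = towardsCorner x≢c (proj₂ (proj₁ (proj₂ spanning) x c tt tt))
    where
    -- follow a T-path from x to c up to its last vertex before c
    towardsCorner : ∀ {x} → x ≢ c → Star (λ u w → ⊤ × ⊤ × T u w) x c →
      Σ (Fin n) λ v → T c v × Comp T c v x
    towardsCorner x≢c ε = ⊥-elim (x≢c refl)
    towardsCorner {x} x≢c (_◅_ {j = y} (_ , _ , t) path) with y FP.≟ c
    ... | yes refl = x , T-sym x c t , x≢c , ε
    ... | no y≢c =
      let (v , tcv , v≢c , v⇝y) = towardsCorner y≢c path
      in v , tcv , v≢c , v⇝y ◅◅ (y≢c , x≢c , T-sym x y t) ◅ ε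

  -- The minimality of the T-neighbours of c, in negative form: no vertex of
  -- V_v other than v that is adjacent to c lies O_h-below v.
  CornerMinimal : Set
  CornerMinimal = ∀ {v w} → T c v → Comp T c v w → G c w → w ≢ v → ¬ (w <O v)

  cornerMinimal⇒IsMinO : CornerMinimal → ∀ {v} → T c v → IsMinO h (λ w → Comp T c v w × G c w) v
  cornerMinimal⇒IsMinO minimal tcv =
    ((neighbour≢c tcv , ε) , T⊆G tcv) ,
    λ w (w∈ , cw) w≢v → <O-connex w _ w≢v (minimal tcv w∈ cw w≢v)

  ComponentsNBC : Set
  ComponentsNBC = (v : Fin n) → T c v →
    IsNBCTree h (Comp T c v) G (Restrict T (Comp T c v)) × IsMinO h (λ w → Comp T c v w × G c w) v

  componentsNBC⇒cornerMinimal : ComponentsNBC → CornerMinimal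
  componentsNBC⇒cornerMinimal rhs {v} tcv w∈ cw w≢v w<v =
    <O-asym (proj₂ (proj₂ (rhs v tcv)) _ (w∈ , cw) w≢v) w<v

  OffCornerWalk : Fin n → List (Fin n) → Set
  OffCornerWalk v zs = ∀ e → e ∈ walkEdges v zs → OffCorner (proj₁ e) (proj₂ e)

  offCornerWalk-avoids : ∀ {v} zs → v ≢ c → OffCornerWalk v zs → All (_≢ c) (v ∷ zs)
  offCornerWalk-avoids {v} zs v≢c steps = v≢c ∷ walkEdges-targets v zs (λ e p → proj₁ (proj₂ (steps e p)))

  cornerCircle-edges : ∀ {e} v zs → e ∈ cycEdges (c ∷ v ∷ zs) →
    e ≡ (c , v) ⊎ e ∈ walkEdges v zs ⊎ e ≡ (endpoint v zs , c)
  cornerCircle-edges v zs m with cycEdge-cases c (v ∷ zs) m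
  ... | inj₁ (here p) = inj₁ p
  ... | inj₁ (there p) = inj₂ (inj₁ p)
  ... | inj₂ p = inj₂ (inj₂ p)

  cornerCircle-isCircle : ∀ {v} zs → T c v → Unique (v ∷ zs) → 1 ≤ length zs → OffCornerWalk v zs →
    G c (endpoint v zs) → IsCircle Full G (c ∷ v ∷ zs)
  cornerCircle-isCircle {v} zs tcv simple nonempty steps cw =
    s≤s (s≤s nonempty) ,
    All.map (λ x≢c c≡x → x≢c (sym c≡x)) (offCornerWalk-avoids zs (neighbour≢c tcv) steps) ∷ simple ,
    All.universal (λ _ → tt) _ , All.tabulate inG
    where
    inG : ∀ {e} → e ∈ cycEdges (c ∷ v ∷ zs) → G (proj₁ e) (proj₂ e)
    inG m with cornerCircle-edges v zs m
    ... | inj₁ refl = T⊆G tcv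
    ... | inj₂ (inj₁ p) = T⊆G (proj₂ (proj₂ (steps _ p)))
    ... | inj₂ (inj₂ refl) = G-sym cw

  cornerCircle-brokenCircuit : ∀ {v} zs → T c v → OffCornerWalk v zs → endpoint v zs <O v →
    ContainsBrokenCircuit h T (c ∷ v ∷ zs)
  cornerCircle-brokenCircuit {v} zs tcv steps w<v =
    (w , c) , closingEdge∈cycle c (v ∷ zs) , larger
    where
    w = endpoint v zs
    v≢c = neighbour≢c tcv
    larger : ∀ e' → e' ∈ cycEdges (c ∷ v ∷ zs) → ¬ SameEdge (w , c) e' →
      EdgeLt h (w , c) e' × T (proj₁ e') (proj₂ e')
    larger e' m ns with cornerCircle-edges v zs m
    ... | inj₁ refl =
      cornerEdges-order (proj₁ (cornerEdge-in w)) (proj₁ (cornerEdge-out v v≢c))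
        (proj₂ (cornerEdge-in w)) (proj₂ (cornerEdge-out v v≢c)) w<v , tcv
    ... | inj₂ (inj₁ p) =
      let (x≢c , y≢c , t) = steps _ p in cornerEdge<avoiding (proj₁ (cornerEdge-in w)) x≢c y≢c , t
    ... | inj₂ (inj₂ refl) = ⊥-elim (ns (inj₁ (refl , refl)))

  NBC⇒cornerMinimal : IsNBCSet h Full G T → CornerMinimal
  NBC⇒cornerMinimal (_ , _ , nbc) {v} {w} tcv (v≢c , v⇝w) cw w≢v w<v
    with star→walk v⇝w
  ... | ys , steps , ys-end with shortcut {R = λ e → OffCorner (proj₁ e) (proj₂ e)} v ys steps
  ... | zs , simple , steps′ , zs-end = closeUp zs simple steps′ (trans zs-end ys-end)
    where
    closeUp : ∀ zs → Unique (v ∷ zs) → OffCornerWalk v zs → endpoint v zs ≡ w → ⊥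
    closeUp [] _ _ refl = w≢v refl
    closeUp zs@(_ ∷ _) simple steps refl =
      nbc (c ∷ v ∷ zs) (cornerCircle-isCircle zs tcv simple (s≤s z≤n) steps cw)
        (all-balanced (c ∷ v ∷ zs)) (cornerCircle-brokenCircuit zs tcv steps w<v)

  forward : IsNBCTree h Full G T → ComponentsNBC
  forward (nbc , _) v tcv =
    (NBC-restrict (Comp T c v) nbc , component-spanning v) ,
    cornerMinimal⇒IsMinO (NBC⇒cornerMinimal nbc) tcv

  record BrokenCircle (w₀ : Fin n) (ws : List (Fin n)) : Set where
    field
      simple : Unique (w₀ ∷ ws)
      long : 3 ≤ length (w₀ ∷ ws)
      closing∈G : G (endpoint w₀ ws) w₀
      walk-broken : ∀ e → e ∈ walkEdges w₀ ws →
        EdgeLt h (endpoint w₀ ws , w₀) e × T (proj₁ e) (proj₂ e)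

  brokenCircle-rotate : ∀ vs → IsCircle Full G vs → ContainsBrokenCircuit h T vs →
    Σ (Fin n) λ w₀ → Σ (List (Fin n)) (BrokenCircle w₀)
  brokenCircle-rotate vs (len , uq , _ , inG) (e , e∈ , larger) with rotate vs e∈
  ... | record { start = w₀ ; rest = ws ; perm = perm ; walk⊆cycle = walk⊆ ; closing = refl } =
    let simple = unique-resp-↭ (↭-sym perm) uq
        long = subst (3 ≤_) (sym (↭-length perm)) len
    in w₀ , ws , record
      { simple = simple ; long = long ; closing∈G = All.lookup inG e∈
      ; walk-broken = λ e' p → larger e' (walk⊆ e' p) (closing≠walkEdge w₀ ws simple long p) }

  brokenCircle-circuit : ∀ {w₀ ws} → BrokenCircle w₀ ws →
    IsCircle Full G (w₀ ∷ ws) × ContainsBrokenCircuit h T (w₀ ∷ ws)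
  brokenCircle-circuit {w₀} {ws} bc =
    (long , simple , All.universal (λ _ → tt) _ , All.tabulate inG) ,
    (_ , closingEdge∈cycle w₀ ws , larger)
    where
    open BrokenCircle bc
    inG : ∀ {e} → e ∈ cycEdges (w₀ ∷ ws) → G (proj₁ e) (proj₂ e)
    inG m with cycEdge-cases w₀ ws m
    ... | inj₁ p = T⊆G (proj₂ (walk-broken _ p))
    ... | inj₂ refl = closing∈G
    larger : ∀ e → e ∈ cycEdges (w₀ ∷ ws) → ¬ SameEdge (endpoint w₀ ws , w₀) e →
      EdgeLt h (endpoint w₀ ws , w₀) e × T (proj₁ e) (proj₂ e)
    larger e m ns with cycEdge-cases w₀ ws m
    ... | inj₁ p = walk-broken e p
    ... | inj₂ refl = ⊥-elim (ns (inj₁ (refl , refl)))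

  -- the smallest edge of a broken circle through c contains c, since an edge
  -- of the walk leaving c would be smaller than any edge avoiding c
  closing-at-corner : ∀ {w₀ ws} → c ∈ w₀ ∷ ws → BrokenCircle w₀ ws → endpoint w₀ ws ≡ c ⊎ w₀ ≡ c
  closing-at-corner {w₀} {ws} c∈ bc with endpoint w₀ ws FP.≟ c | w₀ FP.≟ c
  ... | yes L≡c | _ = inj₁ L≡c
  ... | no _ | yes w₀≡c = inj₂ w₀≡c
  ... | no L≢c | no w₀≢c with extendedWalk-out w₀ ws w₀ c∈
  ...   | y , out with ∈-++⁻ (walkEdges w₀ ws) out
  ...     | inj₂ (here c,y≡L,w₀) = ⊥-elim (L≢c (sym (cong proj₁ c,y≡L,w₀)))
  ...     | inj₁ p =
    let (lt , t) = BrokenCircle.walk-broken bc _ p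
        y≢c = λ y≡c → G-irrefl (T⊆G t) (sym y≡c)
    in ⊥-elim (avoiding≮cornerEdge L≢c w₀≢c (proj₁ (cornerEdge-out y y≢c)) lt)

  module Backward (minimal : CornerMinimal)
                  (componentNBC : ∀ v → T c v → IsNBCSet h (Comp T c v) G (Restrict T (Comp T c v))) where

    -- a broken circle avoiding c lies in one component V_v, against its NBC property
    avoidsCorner : ∀ {w₀ ws} → All (_≢ c) (w₀ ∷ ws) → BrokenCircle w₀ ws → ⊥
    avoidsCorner {w₀} {ws} avoid bc with comp-of-neighbour w₀ (All.head avoid)
    ... | v , tcv , w₀∈ =
      let inV = comp-walk w₀ ws w₀∈ (λ e p → proj₂ (BrokenCircle.walk-broken bc e p)) avoid
          (circle , cbc) = brokenCircle-circuit bc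
      in proj₂ (proj₂ (componentNBC v tcv)) (w₀ ∷ ws) (circle-restrict inV circle)
           (all-balanced (w₀ ∷ ws)) (brokenCircuit-restrict (w₀ ∷ ws) inV cbc)

    -- if the smallest edge is (L , c), the walk c, w₁, …, L shows L ∈ V_{w₁} with L <O w₁
    startsAtCorner : ∀ ws → BrokenCircle c ws → ⊥
    startsAtCorner [] record { long = s≤s () }
    startsAtCorner (w₁ ∷ []) record { long = s≤s (s≤s ()) }
    startsAtCorner (w₁ ∷ r ∷ rs) bc = minimal tcw₁ L∈Vw₁ (G-sym closing∈G) L≢w₁ L<w₁
      where
      open BrokenCircle bc
      L = endpoint r rs
      avoid : All (_≢ c) (w₁ ∷ r ∷ rs)
      avoid = All.map (λ c≢x x≡c → c≢x (sym x≡c)) (AllPairs.head simple)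
      w₁≢c = All.head avoid
      tcw₁ : T c w₁
      tcw₁ = proj₂ (walk-broken _ (here refl))
      L≢w₁ : L ≢ w₁
      L≢w₁ L≡w₁ = All.lookup (AllPairs.head (AllPairs.tail simple)) (endpoint-∈ r rs) (sym L≡w₁)
      steps : ∀ e → e ∈ walkEdges w₁ (r ∷ rs) → OffCorner (proj₁ e) (proj₂ e)
      steps e p = let (x∈ , y∈) = walkEdge-ends w₁ (r ∷ rs) p in
        All.lookup avoid x∈ , All.lookup avoid (there y∈) , proj₂ (walk-broken e (there p))
      L∈Vw₁ : Comp T c w₁ L
      L∈Vw₁ = w₁≢c , walk→star w₁ (r ∷ rs) steps
      L<w₁ : L <O w₁
      L<w₁ = cornerEdges-compare (proj₁ (cornerEdge-in L)) (proj₁ (cornerEdge-out w₁ w₁≢c))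
        (proj₂ (cornerEdge-in L)) (proj₂ (cornerEdge-out w₁ w₁≢c)) (proj₁ (walk-broken _ (here refl)))

    -- if the smallest edge is (c , w₀), the walk w₀, …, p, c shows w₀ ∈ V_p with w₀ <O p
    endsAtCorner-split : ∀ {w₀} A → BrokenCircle w₀ (A ++ c ∷ []) → ⊥
    endsAtCorner-split [] record { long = s≤s (s≤s ()) }
    endsAtCorner-split {w₀} A@(a ∷ A') bc = minimal tcp w₀∈Vp cw₀ w₀≢p w₀<p
      where
      open BrokenCircle bc
      p = endpoint w₀ A
      L≡c : endpoint w₀ (A ++ c ∷ []) ≡ c
      L≡c = endpoint-++ w₀ A c []
      lastStep : (p , c) ∈ walkEdges w₀ (A ++ c ∷ [])
      lastStep = subst ((p , c) ∈_) (sym (walkEdges-++ w₀ A c [])) (∈-++⁺ʳ (walkEdges w₀ A) (here refl))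
      earlier : ∀ {e} → e ∈ walkEdges w₀ A → e ∈ walkEdges w₀ (A ++ c ∷ [])
      earlier {e} q = subst (e ∈_) (sym (walkEdges-++ w₀ A c [])) (∈-++⁺ˡ q)
      avoid : All (_≢ c) (w₀ ∷ A)
      avoid = unique-init (w₀ ∷ A) simple
      w₀≢c = All.head avoid
      p≢c = All.lookup avoid (endpoint-∈ w₀ A)
      tcp : T c p
      tcp = T-sym p c (proj₂ (walk-broken _ lastStep))
      w₀≢p : w₀ ≢ p
      w₀≢p = All.lookup (AllPairs.head simple) (∈-++⁺ˡ (endpoint-∈ a A'))
      steps : ∀ e → e ∈ walkEdges w₀ A → OffCorner (proj₁ e) (proj₂ e)
      steps e q = let (x∈ , y∈) = walkEdge-ends w₀ A q in
        All.lookup avoid x∈ , All.lookup avoid (there y∈) , proj₂ (walk-broken e (earlier q))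
      w₀∈Vp : Comp T c p w₀
      w₀∈Vp = p≢c , Star.reverse offCorner-sym (walk→star w₀ A steps)
      cw₀ : G c w₀
      cw₀ = subst (λ x → G x w₀) L≡c closing∈G
      w₀<p : w₀ <O p
      w₀<p = cornerEdges-compare
        (trans (cong (λ x → minO h x w₀) L≡c) (proj₁ (cornerEdge-out w₀ w₀≢c))) (proj₁ (cornerEdge-in p))
        (trans (cong (λ x → maxO h x w₀) L≡c) (proj₂ (cornerEdge-out w₀ w₀≢c))) (proj₂ (cornerEdge-in p))
        (proj₁ (walk-broken _ lastStep))

    endsAtCorner : ∀ {w₀} ws → endpoint w₀ ws ≡ c → BrokenCircle w₀ ws → ⊥
    endsAtCorner [] _ record { long = s≤s () }
    endsAtCorner {w₀} (y ∷ ys) L≡c bc =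
      let (A , split) = init-last y ys
      in endsAtCorner-split A (subst (BrokenCircle w₀) (trans split (cong (λ x → A ++ x ∷ []) L≡c)) bc)

    noBrokenCircle : ∀ {w₀ ws} → BrokenCircle w₀ ws → ⊥
    noBrokenCircle {w₀} {ws} bc with c ∈? (w₀ ∷ ws)
    ... | no c∉ = avoidsCorner (All.map (λ c≢x x≡c → c≢x (sym x≡c)) (¬Any⇒All¬ _ c∉)) bc
    ... | yes c∈ with closing-at-corner c∈ bc
    ...   | inj₁ L≡c = endsAtCorner ws L≡c bc
    ...   | inj₂ w₀≡c = startsAtCorner ws (subst (λ x → BrokenCircle x ws) w₀≡c bc)

  backward : ComponentsNBC → IsNBCTree h Full G T
  backward rhs = (proj₁ spanning , proj₂ (proj₂ spanning) , noBrokenCircuit) , spanning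
    where
    open Backward (componentsNBC⇒cornerMinimal rhs) (λ v tcv → proj₁ (proj₁ (rhs v tcv)))
    -- every circle of G is balanced
    noBrokenCircuit : ∀ vs → IsCircle Full G vs → IsBalanced h vs → ¬ ContainsBrokenCircuit h T vs
    noBrokenCircuit vs circle _ cbc =
      let (_ , _ , bc) = brokenCircle-rotate vs circle cbc in noBrokenCircle bc

mainTheorem2 : (a b : ℤ) → a Data.Integer.≤ b → (n : ℕ) → 1 ≤ n
    → (h : Fin n → ℕ) → IsHeightFunction h
    → (c : Fin n) → IsCorner h c
    → (T : Fin n → Fin n → Set) → (∀ u v → T u v → T v u)
    → IsSpanningTree Full (KAdj a b h) T
    → IsNBCTree h Full (KAdj a b h) T
    ⇔ ((v : Fin n) → T c v
    → IsNBCTree h (Comp T c v) (KAdj a b h) (Restrict T (Comp T c v))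
    × IsMinO h (λ w → Comp T c v w × KAdj a b h c w) v)
mainTheorem2 a b _ n _ h _ c corner T T-sym spanning = mk⇔ forward backward
  where open Main a b h c corner T T-sym spanning
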